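{- Let $M=(E,\Delta)$ be a matroid of rank $r$ and let $M\times e$ denote its free coextension by a new element $e\notin E$. Then $$(-1)^{r+1}\chi_{M\times e}(-q) = (1+q)\,f_M(q).$$
   Context: For a matroid $N$ of rank $r_N$ on ground set $E_N$ with rank function $\mathrm{rk}$, the characteristic polynomial is $\chi_N(q)=\sum_{A\subseteq E_N}(-1)^{|A|}q^{r_N-\mathrm{rk}(A)}$, and the $f$-polynomial is $f_N(q)=\sum_{A\in\Delta_N} q^{r_N-|A|}=\sum_{i=0}^{r_N} f_i q^{r_N-i}$, where $\Delta_N$ is the set of independent sets and $f_i$ the number of independent sets of size $i$. The free extension of a matroid $M=(E,\Delta)$ of rank $r$ by $e\notin E$ is the matroid $M+e$ on $E\cup\{e\}$ with independent sets $\Delta\cup\{I\cup\{e\}: I\in\Delta,\ |I|\le r-1\}$. The dual matroid $M^*$ has as independent sets those $A\subseteq E$ with $\mathrm{rk}(E\setminus A)=r$. The free coextension is $M\times e := (M^*+e)^*$. -}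

module Defs where

open import Data.Bool using (Bool; true; false; _∧_; not; if_then_else_)
open import Data.Nat as ℕ using (ℕ; zero; suc; _<ᵇ_; _≡ᵇ_; _<_; _⊔_; _∸_)
open import Data.Integer as ℤ using (ℤ; +_; -_)
open import Data.Fin using (Fin)
open import Data.Fin.Subset using (Subset; _⊆_; _∈_; _∉_; _∪_; ⁅_⁆; ∁; ∣_∣; ⊥; ⊤)
open import Data.List using (List; []; _∷_; map; _++_; foldr; filter)
open import Data.Vec using (Vec; []; _∷_)
open import Data.Product using (∃; _×_; _,_)
open import Relation.Binary.PropositionalEquality using (_≡_)

IndepPred : ℕ → Set
IndepPred n = Subset n → Bool

record IsMatroid {n : ℕ} (I : IndepPred n) : Set where
  field
    empty-indep : I ⊥ ≡ true
    hereditary  : ∀ A B → B ⊆ A → I A ≡ true → I B ≡ true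
    exchange    : ∀ A B → I A ≡ true → I B ≡ true → ∣ A ∣ < ∣ B ∣ →
                  ∃ λ x → x ∈ B × x ∉ A × I (A ∪ ⁅ x ⁆) ≡ true

allSubsets : (n : ℕ) → List (Subset n)
allSubsets zero    = [] ∷ []
allSubsets (suc n) = map (false ∷_) (allSubsets n) ++ map (true ∷_) (allSubsets n)

subsetᵇ : {n : ℕ} → Subset n → Subset n → Bool
subsetᵇ []           []           = true
subsetᵇ (false ∷ xs) (_ ∷ ys)     = subsetᵇ xs ys
subsetᵇ (true ∷ xs)  (true ∷ ys)  = subsetᵇ xs ys
subsetᵇ (true ∷ xs)  (false ∷ ys) = false

rk : {n : ℕ} → IndepPred n → Subset n → ℕ
rk {n} I A = foldr (λ B m → if I B ∧ subsetᵇ B A then ∣ B ∣ ⊔ m else m) 0 (allSubsets n)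

rank : {n : ℕ} → IndepPred n → ℕ
rank I = rk I ⊤

dual : {n : ℕ} → IndepPred n → IndepPred n
dual I A = rk I (∁ A) ≡ᵇ rank I

-- free extension by a new element e, placed at index zero of Fin (suc n):
-- independent sets are I and I ∪ {e} with I independent, |I| ≤ r - 1.
freeExt : {n : ℕ} → IndepPred n → IndepPred (suc n)
freeExt I (false ∷ A) = I A
freeExt I (true ∷ A)  = I A ∧ (∣ A ∣ <ᵇ rank I)

freeCoext : {n : ℕ} → IndepPred n → IndepPred (suc n)
freeCoext I = dual (freeExt (dual I))

sumℤ : List ℤ → ℤ
sumℤ = foldr ℤ._+_ (+ 0)

χ : {n : ℕ} → IndepPred n → ℤ → ℤ
χ {n} I q = sumℤ (map (λ A → ((- (+ 1)) ℤ.^ ∣ A ∣) ℤ.* (q ℤ.^ (rank I ∸ rk I A))) (allSubsets n))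

fpoly : {n : ℕ} → IndepPred n → ℤ → ℤ
fpoly {n} I q = sumℤ (map (λ A → if I A then q ℤ.^ (rank I ∸ ∣ A ∣) else + 0) (allSubsets n))

-- In M × e a set containing e, say A ∪ e, is independent iff A is independent in M, and a set
-- A ⊆ E is independent iff |A| ≤ rk A + 1; both follow from the rank formula of the dual matroid
-- and the rank of a free extension, rk (N + e) (W ∪ e) = min (rk W + 1) r_N.  Hence
-- rk (A ∪ e) = rk A + 1, while rk A is |A| for independent A and rk A + 1 otherwise.  Grouping the
-- terms of χ_{M×e}(-q) in pairs A, A ∪ e, a pair cancels when A is dependent and contributes
-- ±(1 + q) q^(r - |A|) when A is independent.
module Submission where

open import Defs

import Algebra.Lattice.Properties.BooleanAlgebra as BooleanAlgebraProperties
open import Data.Bool using (true; false; _∧_; if_then_else_)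
open import Data.Bool.Properties using (T-≡)
open import Data.Empty using (⊥-elim)
open import Data.Fin using (zero; suc)
open import Data.Fin.Subset using (Subset; _⊆_; _⊂_; _∈_; _∉_; _∪_; _∩_; ⁅_⁆; ∁; ∣_∣; ⊥; ⊤)
open import Data.Fin.Subset.Properties
open import Data.Integer as ℤ using (ℤ; 0ℤ; 1ℤ; -1ℤ)
import Data.Integer.Properties as ℤ
import Algebra.Properties.CommutativeSemigroup ℤ.+-commutativeSemigroup as ℤ+
open import Data.Integer.Tactic.RingSolver using (solve-∀)
open import Data.List using (List; []; _∷_; map; _++_; foldr)
open import Data.List.Membership.Propositional using () renaming (_∈_ to _∈ₗ_)
open import Data.List.Membership.Propositional.Properties using (∈-map⁺; ∈-++⁺ˡ; ∈-++⁺ʳ)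
open import Data.List.Properties using (map-++; map-∘; map-cong)
import Data.List.Relation.Unary.Any as Any
open import Data.Nat using (ℕ; zero; suc; _+_; _≤_; _<_; _⊔_; _⊓_; _∸_; _≡ᵇ_; _<ᵇ_; z≤n; s≤s)
open import Data.Nat.Properties
open import Algebra.Properties.CommutativeSemigroup +-commutativeSemigroup using (xy∙z≈xz∙y)
open import Data.Product using (∃; _×_; _,_; proj₁; proj₂)
open import Data.Sum using (_⊎_; inj₁; inj₂)
open import Data.Vec using ([]; _∷_; here; there)
open import Function using (_∘_; _⟨_⟩_)
open import Function.Bundles using (_⇔_; mk⇔; Equivalence)
import Function.Properties.Equivalence as ⇔
open import Relation.Binary.PropositionalEquality

open Equivalence using (to; from)

∧-true : ∀ {a b} → a ≡ true → b ≡ true → a ∧ b ≡ true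
∧-true refl refl = refl

∧-true⁻ : ∀ {a b} → a ∧ b ≡ true → a ≡ true × b ≡ true
∧-true⁻ {true} {true} _ = refl , refl

≡ᵇ-true⇔ : ∀ {m k} → (m ≡ᵇ k) ≡ true ⇔ m ≡ k
≡ᵇ-true⇔ {m} {k} = mk⇔ (≡ᵇ⇒≡ m k ∘ from T-≡) (to T-≡ ∘ ≡⇒≡ᵇ m k)

<ᵇ-true⇔ : ∀ {m k} → (m <ᵇ k) ≡ true ⇔ m < k
<ᵇ-true⇔ {m} {k} = mk⇔ (<ᵇ⇒< m k ∘ from T-≡) (to T-≡ ∘ <⇒<ᵇ)

≡-resp-⇔ : ∀ {A : Set} {a a′ b b′ : A} → a ≡ a′ → b ≡ b′ → (a ≡ b) ⇔ (a′ ≡ b′)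
≡-resp-⇔ refl refl = ⇔.refl

m⊓n≡n⇔n≤m : ∀ {m n} → m ⊓ n ≡ n ⇔ n ≤ m
m⊓n≡n⇔n≤m = mk⇔ m⊓n≡n⇒n≤m m≥n⇒m⊓n≡n

∁-involutive : ∀ {n} (p : Subset n) → ∁ (∁ p) ≡ p
∁-involutive {n} = BooleanAlgebraProperties.¬-involutive (∪-∩-booleanAlgebra n)

∁⊥≡⊤ : ∀ {n} → ∁ ⊥ ≡ ⊤ {n}
∁⊥≡⊤ = trans (sym (∪-identityˡ (∁ ⊥))) (∪-inverseʳ ⊥)

∁⊤≡⊥ : ∀ {n} → ∁ ⊤ ≡ ⊥ {n}
∁⊤≡⊥ = trans (sym (∩-identityˡ (∁ ⊤))) (∩-inverseʳ ⊤)

∣p∣+∣∁p∣≡n : ∀ {n} (p : Subset n) → ∣ p ∣ + ∣ ∁ p ∣ ≡ n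
∣p∣+∣∁p∣≡n p = trans (cong (∣ p ∣ +_) (∣∁p∣≡n∸∣p∣ p)) (m+[n∸m]≡n (∣p∣≤n p))

∣p∣≡∣p∩q∣+∣p∩∁q∣ : ∀ {n} (p q : Subset n) → ∣ p ∣ ≡ ∣ p ∩ q ∣ + ∣ p ∩ ∁ q ∣
∣p∣≡∣p∩q∣+∣p∩∁q∣ []          []          = refl
∣p∣≡∣p∩q∣+∣p∩∁q∣ (true ∷ p)  (true ∷ q)  = cong suc (∣p∣≡∣p∩q∣+∣p∩∁q∣ p q)
∣p∣≡∣p∩q∣+∣p∩∁q∣ (true ∷ p)  (false ∷ q) =
  trans (cong suc (∣p∣≡∣p∩q∣+∣p∩∁q∣ p q)) (sym (+-suc _ _))
∣p∣≡∣p∩q∣+∣p∩∁q∣ (false ∷ p) (_ ∷ q)     = ∣p∣≡∣p∩q∣+∣p∩∁q∣ p q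

∣p∪⁅x⁆∣≡1+∣p∣ : ∀ {n} (p : Subset n) x → x ∉ p → ∣ p ∪ ⁅ x ⁆ ∣ ≡ suc ∣ p ∣
∣p∪⁅x⁆∣≡1+∣p∣ (true ∷ p)  zero    x∉p = ⊥-elim (x∉p here)
∣p∪⁅x⁆∣≡1+∣p∣ (false ∷ p) zero    x∉p = cong (suc ∘ ∣_∣) (∪-identityʳ p)
∣p∪⁅x⁆∣≡1+∣p∣ (true ∷ p)  (suc x) x∉p = cong suc (∣p∪⁅x⁆∣≡1+∣p∣ p x (drop-not-there x∉p))
∣p∪⁅x⁆∣≡1+∣p∣ (false ∷ p) (suc x) x∉p = ∣p∪⁅x⁆∣≡1+∣p∣ p x (drop-not-there x∉p)

p⊆r∧x∈r⇒p∪⁅x⁆⊆r : ∀ {n} {p r : Subset n} {x} → p ⊆ r → x ∈ r → p ∪ ⁅ x ⁆ ⊆ r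
p⊆r∧x∈r⇒p∪⁅x⁆⊆r {p = p} {x = x} p⊆r x∈r {y} y∈p∪x with x∈p∪q⁻ p ⁅ x ⁆ y∈p∪x
... | inj₁ y∈p = p⊆r y∈p
... | inj₂ y∈x rewrite x∈⁅y⁆⇒x≡y x y∈x = x∈r

p⊆q∧∣p∣≡∣q∣⇒p≡q : ∀ {n} (p q : Subset n) → p ⊆ q → ∣ p ∣ ≡ ∣ q ∣ → p ≡ q
p⊆q∧∣p∣≡∣q∣⇒p≡q []          []          _   _ = refl
p⊆q∧∣p∣≡∣q∣⇒p≡q (true ∷ p)  (true ∷ q)  p⊆q e =
  cong (true ∷_) (p⊆q∧∣p∣≡∣q∣⇒p≡q p q (drop-∷-⊆ p⊆q) (suc-injective e))
p⊆q∧∣p∣≡∣q∣⇒p≡q (false ∷ p) (false ∷ q) p⊆q e =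
  cong (false ∷_) (p⊆q∧∣p∣≡∣q∣⇒p≡q p q (drop-∷-⊆ p⊆q) e)
p⊆q∧∣p∣≡∣q∣⇒p≡q (true ∷ p)  (false ∷ q) p⊆q e with p⊆q here
... | ()
p⊆q∧∣p∣≡∣q∣⇒p≡q (false ∷ p) (true ∷ q)  p⊆q e =
  ⊥-elim (<-irrefl e (s≤s (p⊆q⇒∣p∣≤∣q∣ (drop-∷-⊆ p⊆q))))

p⊆q∧∣p∣<∣q∣⇒p⊂q : ∀ {n} (p q : Subset n) → p ⊆ q → ∣ p ∣ < ∣ q ∣ → p ⊂ q
p⊆q∧∣p∣<∣q∣⇒p⊂q (true ∷ p)  (true ∷ q)  p⊆q (s≤s lt) =
  s⊂s (p⊆q∧∣p∣<∣q∣⇒p⊂q p q (drop-∷-⊆ p⊆q) lt)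
p⊆q∧∣p∣<∣q∣⇒p⊂q (false ∷ p) (false ∷ q) p⊆q lt       =
  s⊂s (p⊆q∧∣p∣<∣q∣⇒p⊂q p q (drop-∷-⊆ p⊆q) lt)
p⊆q∧∣p∣<∣q∣⇒p⊂q (false ∷ p) (true ∷ q)  p⊆q _        = out⊂in (drop-∷-⊆ p⊆q)
p⊆q∧∣p∣<∣q∣⇒p⊂q (true ∷ p)  (false ∷ q) p⊆q _ with p⊆q here
... | ()

∈-allSubsets : ∀ {n} (A : Subset n) → A ∈ₗ allSubsets n
∈-allSubsets []                = Any.here refl
∈-allSubsets {suc n} (false ∷ A) = ∈-++⁺ˡ (∈-map⁺ (false ∷_) (∈-allSubsets A))
∈-allSubsets {suc n} (true ∷ A)  =
  ∈-++⁺ʳ (map (false ∷_) (allSubsets n)) (∈-map⁺ (true ∷_) (∈-allSubsets A))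

⊆⇒subsetᵇ : ∀ {n} (B A : Subset n) → B ⊆ A → subsetᵇ B A ≡ true
⊆⇒subsetᵇ []          []          _   = refl
⊆⇒subsetᵇ (false ∷ B) (_ ∷ A)     B⊆A = ⊆⇒subsetᵇ B A (drop-∷-⊆ B⊆A)
⊆⇒subsetᵇ (true ∷ B)  (true ∷ A)  B⊆A = ⊆⇒subsetᵇ B A (drop-∷-⊆ B⊆A)
⊆⇒subsetᵇ (true ∷ B)  (false ∷ A) B⊆A with B⊆A here
... | ()

subsetᵇ⇒⊆ : ∀ {n} (B A : Subset n) → subsetᵇ B A ≡ true → B ⊆ A
subsetᵇ⇒⊆ (false ∷ B) (_ ∷ A)    e (there x∈B) = there (subsetᵇ⇒⊆ B A e x∈B)
subsetᵇ⇒⊆ (true ∷ B)  (true ∷ A) e here        = here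
subsetᵇ⇒⊆ (true ∷ B)  (true ∷ A) e (there x∈B) = there (subsetᵇ⇒⊆ B A e x∈B)

IndepSubset : ∀ {n} → IndepPred n → Subset n → ℕ → Set
IndepSubset I A k = ∃ λ B → B ⊆ A × I B ≡ true × ∣ B ∣ ≡ k

IndepSizes≤ : ∀ {n} → IndepPred n → Subset n → ℕ → Set
IndepSizes≤ I A v = ∀ B → B ⊆ A → I B ≡ true → ∣ B ∣ ≤ v

module _ {n} (I : IndepPred n) (A : Subset n) where

  private
    rkIn : List (Subset n) → ℕ
    rkIn = foldr (λ B m → if I B ∧ subsetᵇ B A then ∣ B ∣ ⊔ m else m) 0

    rkIn-upper : ∀ {B} L → B ∈ₗ L → B ⊆ A → I B ≡ true → ∣ B ∣ ≤ rkIn L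
    rkIn-upper {B} (C ∷ L) (Any.here refl) B⊆A IB rewrite IB | ⊆⇒subsetᵇ B A B⊆A = m≤m⊔n _ _
    rkIn-upper (C ∷ L) (Any.there B∈L) B⊆A IB with I C ∧ subsetᵇ C A
    ... | true  = ≤-trans (rkIn-upper L B∈L B⊆A IB) (m≤n⊔m _ _)
    ... | false = rkIn-upper L B∈L B⊆A IB

    rkIn-lub : ∀ {v} L → IndepSizes≤ I A v → rkIn L ≤ v
    rkIn-lub []      bound = z≤n
    rkIn-lub (C ∷ L) bound with I C ∧ subsetᵇ C A in eq
    ... | true  = ⊔-lub (bound C (subsetᵇ⇒⊆ C A (proj₂ (∧-true⁻ eq))) (proj₁ (∧-true⁻ eq)))
                        (rkIn-lub L bound)
    ... | false = rkIn-lub L bound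

    rkIn-attained : ∀ L → rkIn L ≡ 0 ⊎ IndepSubset I A (rkIn L)
    rkIn-attained []      = inj₁ refl
    rkIn-attained (C ∷ L) with I C ∧ subsetᵇ C A in eq
    ... | false = rkIn-attained L
    ... | true with ⊔-sel ∣ C ∣ (rkIn L)
    ...   | inj₁ ⊔≡∣C∣ = inj₂ (C , subsetᵇ⇒⊆ C A (proj₂ (∧-true⁻ eq)) , proj₁ (∧-true⁻ eq) , sym ⊔≡∣C∣)
    ...   | inj₂ ⊔≡rk rewrite ⊔≡rk = rkIn-attained L

  indep⇒∣∣≤rk : ∀ {B} → B ⊆ A → I B ≡ true → ∣ B ∣ ≤ rk I A
  indep⇒∣∣≤rk {B} = rkIn-upper (allSubsets n) (∈-allSubsets B)

  rk-lub : ∀ {v} → IndepSizes≤ I A v → rk I A ≤ v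
  rk-lub = rkIn-lub (allSubsets n)

  rk-attained : I ⊥ ≡ true → IndepSubset I A (rk I A)
  rk-attained I⊥ with rkIn-attained (allSubsets n)
  ... | inj₂ attained = attained
  ... | inj₁ rk≡0     = ⊥ , ⊥⊆ , I⊥ , trans (∣⊥∣≡0 n) (sym rk≡0)

  rk-characterisation : ∀ {v} → IndepSubset I A v → IndepSizes≤ I A v → rk I A ≡ v
  rk-characterisation (B , B⊆A , IB , ∣B∣≡v) bound =
    ≤-antisym (rk-lub bound) (subst (_≤ rk I A) ∣B∣≡v (indep⇒∣∣≤rk B⊆A IB))

  rk≤∣∣ : rk I A ≤ ∣ A ∣
  rk≤∣∣ = rk-lub (λ B B⊆A _ → p⊆q⇒∣p∣≤∣q∣ B⊆A)

rk-mono : ∀ {n} (I : IndepPred n) {A A′} → A ⊆ A′ → rk I A ≤ rk I A′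
rk-mono I {A} {A′} A⊆A′ = rk-lub I A (λ B B⊆A IB → indep⇒∣∣≤rk I A′ (⊆-trans B⊆A A⊆A′) IB)

rk≤rank : ∀ {n} (I : IndepPred n) A → rk I A ≤ rank I
rk≤rank I A = rk-mono I ⊆⊤

module MatroidProperties {n} {I : IndepPred n} (M : IsMatroid I) where
  open IsMatroid M

  basis : ∀ A → IndepSubset I A (rk I A)
  basis A = rk-attained I A empty-indep

  augment : ∀ {S C} → C ⊆ S → I C ≡ true →
            ∃ λ B → C ⊆ B × B ⊆ S × I B ≡ true × ∣ B ∣ ≡ rk I S
  augment {S} {C} C⊆S IC = go (rk I S ∸ ∣ C ∣) C⊆S IC (m∸n+n≡m (indep⇒∣∣≤rk I S C⊆S IC))
    where
    go : ∀ d {C} → C ⊆ S → I C ≡ true → d + ∣ C ∣ ≡ rk I S →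
         ∃ λ B → C ⊆ B × B ⊆ S × I B ≡ true × ∣ B ∣ ≡ rk I S
    go zero    {C} C⊆S IC ∣C∣≡rk = C , ⊆-refl , C⊆S , IC , ∣C∣≡rk
    go (suc d) {C} C⊆S IC d+∣C∣≡rk with basis S
    ... | W , W⊆S , IW , ∣W∣≡rk
      with exchange C W IC IW (≤-trans (s≤s (m≤n+m ∣ C ∣ d)) (≤-reflexive (trans d+∣C∣≡rk (sym ∣W∣≡rk))))
    ...   | x , x∈W , x∉C , IC+x
      with go d (p⊆r∧x∈r⇒p∪⁅x⁆⊆r C⊆S (W⊆S x∈W)) IC+x
              (trans (cong (d +_) (∣p∪⁅x⁆∣≡1+∣p∣ C x x∉C)) (trans (+-suc d _) d+∣C∣≡rk))
    ...     | B , C+x⊆B , B⊆S , IB , ∣B∣≡rk = B , ⊆-trans (p⊆p∪q ⁅ x ⁆) C+x⊆B , B⊆S , IB , ∣B∣≡rk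

  indep⇒rk≡∣∣ : ∀ {A} → I A ≡ true → rk I A ≡ ∣ A ∣
  indep⇒rk≡∣∣ {A} IA = ≤-antisym (rk≤∣∣ I A) (indep⇒∣∣≤rk I A ⊆-refl IA)

  rk≡∣∣⇒indep : ∀ {A} → rk I A ≡ ∣ A ∣ → I A ≡ true
  rk≡∣∣⇒indep {A} rk≡∣A∣ with basis A
  ... | B , B⊆A , IB , ∣B∣≡rk = subst (λ X → I X ≡ true) (p⊆q∧∣p∣≡∣q∣⇒p≡q B A B⊆A (trans ∣B∣≡rk rk≡∣A∣)) IB

  indep⇔rk≡∣∣ : ∀ {A} → I A ≡ true ⇔ rk I A ≡ ∣ A ∣
  indep⇔rk≡∣∣ = mk⇔ indep⇒rk≡∣∣ rk≡∣∣⇒indep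

  dependent⇒rk<∣∣ : ∀ {A} → I A ≡ false → rk I A < ∣ A ∣
  dependent⇒rk<∣∣ {A} IA with m≤n⇒m<n∨m≡n (rk≤∣∣ I A)
  ... | inj₁ rk<∣A∣ = rk<∣A∣
  ... | inj₂ rk≡∣A∣ with trans (sym IA) (rk≡∣∣⇒indep rk≡∣A∣)
  ...   | ()

module DualProperties {n} {I : IndepPred n} (M : IsMatroid I) where
  open IsMatroid M
  open MatroidProperties M

  dual-empty : dual I ⊥ ≡ true
  dual-empty = from ≡ᵇ-true⇔ (cong (rk I) ∁⊥≡⊤)

  dual-indep-bound : ∀ {X Y} → Y ⊆ X → dual I Y ≡ true → ∣ Y ∣ + rank I ≤ ∣ X ∣ + rk I (∁ X)
  dual-indep-bound {X} {Y} Y⊆X JY with basis (∁ Y)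
  ... | B , B⊆∁Y , IB , ∣B∣≡rk = begin
      ∣ Y ∣ + rank I                            ≡⟨ cong (∣ Y ∣ +_) (trans (sym (to ≡ᵇ-true⇔ JY)) (sym ∣B∣≡rk)) ⟩
      ∣ Y ∣ + ∣ B ∣                             ≡⟨ cong (∣ Y ∣ +_) (∣p∣≡∣p∩q∣+∣p∩∁q∣ B X) ⟩
      ∣ Y ∣ + (∣ B ∩ X ∣ + ∣ B ∩ ∁ X ∣)         ≡⟨ +-assoc ∣ Y ∣ _ _ ⟨
      ∣ Y ∣ + ∣ B ∩ X ∣ + ∣ B ∩ ∁ X ∣           ≤⟨ +-mono-≤ (+-mono-≤ (p⊆q⇒∣p∣≤∣q∣ Y⊆X∩Y) (p⊆q⇒∣p∣≤∣q∣ B∩X⊆X∩∁Y))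
                                                            (indep⇒∣∣≤rk I (∁ X) (p∩q⊆q B (∁ X)) IB∩∁X) ⟩
      ∣ X ∩ Y ∣ + ∣ X ∩ ∁ Y ∣ + rk I (∁ X)      ≡⟨ cong (_+ rk I (∁ X)) (∣p∣≡∣p∩q∣+∣p∩∁q∣ X Y) ⟨
      ∣ X ∣ + rk I (∁ X)                        ∎
    where
    open ≤-Reasoning
    Y⊆X∩Y : Y ⊆ X ∩ Y
    Y⊆X∩Y y∈Y = x∈p∩q⁺ (Y⊆X y∈Y , y∈Y)
    B∩X⊆X∩∁Y : B ∩ X ⊆ X ∩ ∁ Y
    B∩X⊆X∩∁Y x∈B∩X = let x∈B , x∈X = x∈p∩q⁻ B X x∈B∩X in x∈p∩q⁺ (x∈X , B⊆∁Y x∈B)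
    IB∩∁X : I (B ∩ ∁ X) ≡ true
    IB∩∁X = hereditary B (B ∩ ∁ X) (p∩q⊆p B (∁ X)) IB

  -- Extend a basis C of E ∖ X to a basis B of E; then X ∖ B is a maximum dual-independent subset of X.
  dual-indep-attaining : ∀ X → ∃ λ Y → Y ⊆ X × dual I Y ≡ true × ∣ Y ∣ + rank I ≡ ∣ X ∣ + rk I (∁ X)
  dual-indep-attaining X with basis (∁ X)
  ... | C , C⊆∁X , IC , ∣C∣≡rk with augment ⊆⊤ IC
  ...   | B , C⊆B , _ , IB , ∣B∣≡rank = X ∩ ∁ B , p∩q⊆p X (∁ B) , JX∖B , size
    where
    B⊆∁[X∖B] : B ⊆ ∁ (X ∩ ∁ B)
    B⊆∁[X∖B] x∈B = x∉p⇒x∈∁p (λ x∈X∖B → x∈∁p⇒x∉p (proj₂ (x∈p∩q⁻ X (∁ B) x∈X∖B)) x∈B)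
    JX∖B : dual I (X ∩ ∁ B) ≡ true
    JX∖B = from ≡ᵇ-true⇔ (≤-antisym (rk≤rank I _)
             (subst (_≤ rk I (∁ (X ∩ ∁ B))) ∣B∣≡rank (indep⇒∣∣≤rk I _ B⊆∁[X∖B] IB)))
    ∣B∩∁X∣≡rk : ∣ B ∩ ∁ X ∣ ≡ rk I (∁ X)
    ∣B∩∁X∣≡rk = ≤-antisym
      (indep⇒∣∣≤rk I (∁ X) (p∩q⊆q B (∁ X)) (hereditary B (B ∩ ∁ X) (p∩q⊆p B (∁ X)) IB))
      (subst (_≤ ∣ B ∩ ∁ X ∣) ∣C∣≡rk (p⊆q⇒∣p∣≤∣q∣ (λ x∈C → x∈p∩q⁺ (C⊆B x∈C , C⊆∁X x∈C))))
    size : ∣ X ∩ ∁ B ∣ + rank I ≡ ∣ X ∣ + rk I (∁ X)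
    size = begin
      ∣ X ∩ ∁ B ∣ + rank I                        ≡⟨ cong (∣ X ∩ ∁ B ∣ +_) (trans (sym ∣B∣≡rank) (∣p∣≡∣p∩q∣+∣p∩∁q∣ B X)) ⟩
      ∣ X ∩ ∁ B ∣ + (∣ B ∩ X ∣ + ∣ B ∩ ∁ X ∣)     ≡⟨ cong₂ (λ a b → ∣ X ∩ ∁ B ∣ + (a + b)) (cong ∣_∣ (∩-comm B X)) ∣B∩∁X∣≡rk ⟩
      ∣ X ∩ ∁ B ∣ + (∣ X ∩ B ∣ + rk I (∁ X))      ≡⟨ +-assoc ∣ X ∩ ∁ B ∣ _ _ ⟨
      ∣ X ∩ ∁ B ∣ + ∣ X ∩ B ∣ + rk I (∁ X)        ≡⟨ cong (_+ rk I (∁ X)) (trans (+-comm ∣ X ∩ ∁ B ∣ _) (sym (∣p∣≡∣p∩q∣+∣p∩∁q∣ X B))) ⟩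
      ∣ X ∣ + rk I (∁ X)                          ∎
      where open ≡-Reasoning

  rk-dual : ∀ X → rk (dual I) X + rank I ≡ ∣ X ∣ + rk I (∁ X)
  rk-dual X with rk-attained (dual I) X dual-empty | dual-indep-attaining X
  ... | W , W⊆X , JW , ∣W∣≡rk | Y , Y⊆X , JY , ∣Y∣+r≡ = ≤-antisym
    (subst (λ k → k + rank I ≤ ∣ X ∣ + rk I (∁ X)) ∣W∣≡rk (dual-indep-bound W⊆X JW))
    (subst (_≤ rk (dual I) X + rank I) ∣Y∣+r≡ (+-monoˡ-≤ (rank I) (indep⇒∣∣≤rk (dual I) X Y⊆X JY)))

  rank-dual : rank (dual I) + rank I ≡ n
  rank-dual = begin
    rank (dual I) + rank I    ≡⟨ rk-dual ⊤ ⟩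
    ∣ ⊤ {n} ∣ + rk I (∁ ⊤)    ≡⟨ cong₂ _+_ (∣⊤∣≡n n) rk-∁⊤≡0 ⟩
    n + 0                     ≡⟨ +-identityʳ n ⟩
    n                         ∎
    where
    open ≡-Reasoning
    rk-∁⊤≡0 : rk I (∁ ⊤) ≡ 0
    rk-∁⊤≡0 = n≤0⇒n≡0 (≤-trans (rk≤∣∣ I (∁ ⊤)) (≤-reflexive (trans (cong ∣_∣ (∁⊤≡⊥ {n})) (∣⊥∣≡0 n))))

  rk-dual-∁ : ∀ Y → rk (dual I) (∁ Y) + ∣ Y ∣ ≡ rank (dual I) + rk I Y
  rk-dual-∁ Y = +-cancelʳ-≡ (rank I) _ _ (begin
    rk (dual I) (∁ Y) + ∣ Y ∣ + rank I      ≡⟨ xy∙z≈xz∙y (rk (dual I) (∁ Y)) (∣ Y ∣) (rank I) ⟩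
    rk (dual I) (∁ Y) + rank I + ∣ Y ∣      ≡⟨ cong (_+ ∣ Y ∣) (rk-dual (∁ Y)) ⟩
    ∣ ∁ Y ∣ + rk I (∁ (∁ Y)) + ∣ Y ∣        ≡⟨ cong (λ Z → ∣ ∁ Y ∣ + rk I Z + ∣ Y ∣) (∁-involutive Y) ⟩
    ∣ ∁ Y ∣ + rk I Y + ∣ Y ∣                ≡⟨ trans (xy∙z≈xz∙y (∣ ∁ Y ∣) (rk I Y) (∣ Y ∣)) (cong (_+ rk I Y) (+-comm (∣ ∁ Y ∣) (∣ Y ∣))) ⟩
    ∣ Y ∣ + ∣ ∁ Y ∣ + rk I Y                ≡⟨ cong (_+ rk I Y) (trans (∣p∣+∣∁p∣≡n Y) (sym rank-dual)) ⟩
    rank (dual I) + rank I + rk I Y         ≡⟨ xy∙z≈xz∙y (rank (dual I)) (rank I) (rk I Y) ⟩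
    rank (dual I) + rk I Y + rank I         ∎)
    where open ≡-Reasoning

  rk-dual-∁≡rank⇔ : ∀ Y → rk (dual I) (∁ Y) ≡ rank (dual I) ⇔ rk I Y ≡ ∣ Y ∣
  rk-dual-∁≡rank⇔ Y = mk⇔
    (λ a≡R → sym (+-cancelˡ-≡ R _ _ (trans (cong (_+ ∣ Y ∣) (sym a≡R)) (rk-dual-∁ Y))))
    (λ k≡s → +-cancelʳ-≡ ∣ Y ∣ _ _ (trans (rk-dual-∁ Y) (cong (R +_) k≡s)))
    where
    R : ℕ
    R = rank (dual I)

  rank-dual≤1+rk-dual-∁⇔ : ∀ Y → rank (dual I) ≤ suc (rk (dual I) (∁ Y)) ⇔ ∣ Y ∣ ≤ suc (rk I Y)
  rank-dual≤1+rk-dual-∁⇔ Y = mk⇔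
    (λ R≤1+a → +-cancelˡ-≤ R _ _ (begin
      R + ∣ Y ∣           ≤⟨ +-monoˡ-≤ ∣ Y ∣ R≤1+a ⟩
      suc (a + ∣ Y ∣)     ≡⟨ cong suc (rk-dual-∁ Y) ⟩
      suc (R + rk I Y)    ≡⟨ +-suc R _ ⟨
      R + suc (rk I Y)    ∎))
    (λ s≤1+k → +-cancelʳ-≤ ∣ Y ∣ _ _ (begin
      R + ∣ Y ∣           ≤⟨ +-monoʳ-≤ R s≤1+k ⟩
      R + suc (rk I Y)    ≡⟨ +-suc R _ ⟩
      suc (R + rk I Y)    ≡⟨ cong suc (rk-dual-∁ Y) ⟨
      suc a + ∣ Y ∣       ∎))
    where
    open ≤-Reasoning
    R a : ℕ
    R = rank (dual I)
    a = rk (dual I) (∁ Y)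

module FreeExtensionProperties {n} (N : IndepPred n) (N-empty : N ⊥ ≡ true) where

  rk-freeExt-outside : ∀ W → rk (freeExt N) (false ∷ W) ≡ rk N W
  rk-freeExt-outside W = rk-characterisation (freeExt N) (false ∷ W) witness bound
    where
    witness : IndepSubset (freeExt N) (false ∷ W) (rk N W)
    witness with rk-attained N W N-empty
    ... | Z , Z⊆W , NZ , ∣Z∣≡rk = false ∷ Z , out⊆ Z⊆W , NZ , ∣Z∣≡rk
    bound : IndepSizes≤ (freeExt N) (false ∷ W) (rk N W)
    bound (false ∷ C) C⊆ NC = indep⇒∣∣≤rk N W (drop-∷-⊆ C⊆) NC
    bound (true ∷ C)  C⊆ _ with C⊆ here
    ... | ()

  rk-freeExt-inside : ∀ W → rk (freeExt N) (true ∷ W) ≡ suc (rk N W) ⊓ rank N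
  rk-freeExt-inside W = rk-characterisation (freeExt N) (true ∷ W) witness bound
    where
    witness : IndepSubset (freeExt N) (true ∷ W) (suc (rk N W) ⊓ rank N)
    witness with rk-attained N W N-empty | m≤n⇒m<n∨m≡n (rk≤rank N W)
    ... | Z , Z⊆W , NZ , ∣Z∣≡rk | inj₁ rk<rank =
      true ∷ Z , in⊆in Z⊆W , ∧-true NZ (from <ᵇ-true⇔ (subst (_< rank N) (sym ∣Z∣≡rk) rk<rank)) ,
      trans (cong suc ∣Z∣≡rk) (sym (m≤n⇒m⊓n≡m rk<rank))
    ... | Z , Z⊆W , NZ , ∣Z∣≡rk | inj₂ rk≡rank =
      false ∷ Z , out⊆ Z⊆W , NZ ,
      trans ∣Z∣≡rk (trans rk≡rank (sym (m≥n⇒m⊓n≡n (≤-trans (≤-reflexive (sym rk≡rank)) (n≤1+n _)))))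
    bound : IndepSizes≤ (freeExt N) (true ∷ W) (suc (rk N W) ⊓ rank N)
    bound (false ∷ C) C⊆ NC = ⊓-glb (m≤n⇒m≤1+n ∣C∣≤rk) (≤-trans ∣C∣≤rk (rk≤rank N W))
      where
      ∣C∣≤rk : ∣ C ∣ ≤ rk N W
      ∣C∣≤rk = indep⇒∣∣≤rk N W (drop-∷-⊆ C⊆) NC
    bound (true ∷ C)  C⊆ N+C = let NC , ∣C∣<rank = ∧-true⁻ N+C in
      ⊓-glb (s≤s (indep⇒∣∣≤rk N W (drop-∷-⊆ C⊆) NC)) (to <ᵇ-true⇔ ∣C∣<rank)

  rank-freeExt : rank (freeExt N) ≡ rank N
  rank-freeExt = trans (rk-freeExt-inside ⊤) (m≥n⇒m⊓n≡n (n≤1+n (rank N)))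

module FreeCoextensionProperties {n} {I : IndepPred n} (M : IsMatroid I) where
  open MatroidProperties M
  open DualProperties M
  open FreeExtensionProperties (dual I) dual-empty

  -- Independence in (M* + e)* is tested on the complement, which exchanges inside and outside e.
  freeCoext-inside⇔ : ∀ Y → freeCoext I (true ∷ Y) ≡ true ⇔ I Y ≡ true
  freeCoext-inside⇔ Y =
    ≡ᵇ-true⇔ ⟨ ⇔.trans ⟩
    ≡-resp-⇔ (rk-freeExt-outside (∁ Y)) rank-freeExt ⟨ ⇔.trans ⟩
    rk-dual-∁≡rank⇔ Y ⟨ ⇔.trans ⟩
    ⇔.sym indep⇔rk≡∣∣

  freeCoext-outside⇔ : ∀ Y → freeCoext I (false ∷ Y) ≡ true ⇔ ∣ Y ∣ ≤ suc (rk I Y)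
  freeCoext-outside⇔ Y =
    ≡ᵇ-true⇔ ⟨ ⇔.trans ⟩
    ≡-resp-⇔ (rk-freeExt-inside (∁ Y)) rank-freeExt ⟨ ⇔.trans ⟩
    m⊓n≡n⇔n≤m ⟨ ⇔.trans ⟩
    rank-dual≤1+rk-dual-∁⇔ Y

  freeCoext-outside-bound : ∀ {A C} → C ⊆ A → freeCoext I (false ∷ C) ≡ true → ∣ C ∣ ≤ suc (rk I A)
  freeCoext-outside-bound {A} {C} C⊆A FC = ≤-trans (to (freeCoext-outside⇔ C) FC) (s≤s (rk-mono I C⊆A))

  rk-freeCoext-inside : ∀ A → rk (freeCoext I) (true ∷ A) ≡ suc (rk I A)
  rk-freeCoext-inside A = rk-characterisation (freeCoext I) (true ∷ A) witness bound
    where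
    witness : IndepSubset (freeCoext I) (true ∷ A) (suc (rk I A))
    witness with basis A
    ... | B , B⊆A , IB , ∣B∣≡rk = true ∷ B , in⊆in B⊆A , from (freeCoext-inside⇔ B) IB , cong suc ∣B∣≡rk
    bound : IndepSizes≤ (freeCoext I) (true ∷ A) (suc (rk I A))
    bound (true ∷ C)  C⊆ FC = s≤s (indep⇒∣∣≤rk I A (drop-∷-⊆ C⊆) (to (freeCoext-inside⇔ C) FC))
    bound (false ∷ C) C⊆ FC = freeCoext-outside-bound (drop-∷-⊆ C⊆) FC

  rk-freeCoext-outside-indep : ∀ {A} → I A ≡ true → rk (freeCoext I) (false ∷ A) ≡ ∣ A ∣
  rk-freeCoext-outside-indep {A} IA = rk-characterisation (freeCoext I) (false ∷ A)
    (false ∷ A , ⊆-refl , from (freeCoext-outside⇔ A) (m≤n⇒m≤1+n (≤-reflexive (sym (indep⇒rk≡∣∣ IA)))) , refl)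
    (λ C C⊆ _ → p⊆q⇒∣p∣≤∣q∣ C⊆)

  -- The witness is B ∪ x for a basis B of A and some x ∈ A ∖ B, which exists as A is dependent.
  rk-freeCoext-outside-dependent : ∀ {A} → I A ≡ false → rk (freeCoext I) (false ∷ A) ≡ suc (rk I A)
  rk-freeCoext-outside-dependent {A} IA with basis A
  ... | B , B⊆A , IB , ∣B∣≡rk with proj₂ (p⊆q∧∣p∣<∣q∣⇒p⊂q B A B⊆A (subst (_< ∣ A ∣) (sym ∣B∣≡rk) (dependent⇒rk<∣∣ IA)))
  ...   | x , x∈A , x∉B = rk-characterisation (freeCoext I) (false ∷ A)
    (false ∷ (B ∪ ⁅ x ⁆) , out⊆ (p⊆r∧x∈r⇒p∪⁅x⁆⊆r B⊆A x∈A) , from (freeCoext-outside⇔ (B ∪ ⁅ x ⁆)) ∣B+x∣≤1+rk ,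
     trans ∣B+x∣≡1+∣B∣ (cong suc ∣B∣≡rk))
    bound
    where
    ∣B+x∣≡1+∣B∣ : ∣ B ∪ ⁅ x ⁆ ∣ ≡ suc ∣ B ∣
    ∣B+x∣≡1+∣B∣ = ∣p∪⁅x⁆∣≡1+∣p∣ B x x∉B
    ∣B+x∣≤1+rk : ∣ B ∪ ⁅ x ⁆ ∣ ≤ suc (rk I (B ∪ ⁅ x ⁆))
    ∣B+x∣≤1+rk = subst (_≤ suc (rk I (B ∪ ⁅ x ⁆))) (sym ∣B+x∣≡1+∣B∣)
                   (s≤s (indep⇒∣∣≤rk I (B ∪ ⁅ x ⁆) (p⊆p∪q ⁅ x ⁆) IB))
    bound : IndepSizes≤ (freeCoext I) (false ∷ A) (suc (rk I A))
    bound (false ∷ C) C⊆ FC = freeCoext-outside-bound (drop-∷-⊆ C⊆) FC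
    bound (true ∷ C)  C⊆ _ with C⊆ here
    ... | ()

  rank-freeCoext : rank (freeCoext I) ≡ suc (rank I)
  rank-freeCoext = rk-freeCoext-inside ⊤

sumℤ-++ : ∀ xs ys → sumℤ (xs ++ ys) ≡ sumℤ xs ℤ.+ sumℤ ys
sumℤ-++ []       ys = sym (ℤ.+-identityˡ (sumℤ ys))
sumℤ-++ (x ∷ xs) ys = trans (cong (ℤ._+_ x) (sumℤ-++ xs ys)) (sym (ℤ.+-assoc x (sumℤ xs) (sumℤ ys)))

module _ {A : Set} where

  sumℤ-map-+ : ∀ (f g : A → ℤ) xs →
               sumℤ (map f xs) ℤ.+ sumℤ (map g xs) ≡ sumℤ (map (λ x → f x ℤ.+ g x) xs)
  sumℤ-map-+ f g []       = refl
  sumℤ-map-+ f g (x ∷ xs) = trans (ℤ+.interchange (f x) (sumℤ (map f xs)) (g x) (sumℤ (map g xs)))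
                                  (cong (ℤ._+_ (f x ℤ.+ g x)) (sumℤ-map-+ f g xs))

  sumℤ-map-*ˡ : ∀ c (f : A → ℤ) xs → c ℤ.* sumℤ (map f xs) ≡ sumℤ (map (λ x → c ℤ.* f x) xs)
  sumℤ-map-*ˡ c f []       = ℤ.*-zeroʳ c
  sumℤ-map-*ˡ c f (x ∷ xs) = trans (ℤ.*-distribˡ-+ c (f x) (sumℤ (map f xs)))
                                   (cong (ℤ._+_ (c ℤ.* f x)) (sumℤ-map-*ˡ c f xs))

sumℤ-allSubsets-suc : ∀ {n} (F : Subset (suc n) → ℤ) →
  sumℤ (map F (allSubsets (suc n))) ≡ sumℤ (map (λ A → F (false ∷ A) ℤ.+ F (true ∷ A)) (allSubsets n))
sumℤ-allSubsets-suc {n} F = begin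
  sumℤ (map F (map (false ∷_) L ++ map (true ∷_) L))
    ≡⟨ cong sumℤ (map-++ F (map (false ∷_) L) (map (true ∷_) L)) ⟩
  sumℤ (map F (map (false ∷_) L) ++ map F (map (true ∷_) L))
    ≡⟨ sumℤ-++ (map F (map (false ∷_) L)) (map F (map (true ∷_) L)) ⟩
  sumℤ (map F (map (false ∷_) L)) ℤ.+ sumℤ (map F (map (true ∷_) L))
    ≡⟨ cong₂ (λ xs ys → sumℤ xs ℤ.+ sumℤ ys) (map-∘ L) (map-∘ L) ⟨
  sumℤ (map (F ∘ (false ∷_)) L) ℤ.+ sumℤ (map (F ∘ (true ∷_)) L)
    ≡⟨ sumℤ-map-+ (F ∘ (false ∷_)) (F ∘ (true ∷_)) L ⟩
  sumℤ (map (λ A → F (false ∷ A) ℤ.+ F (true ∷ A)) L) ∎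
  where
  open ≡-Reasoning
  L : List (Subset n)
  L = allSubsets n

alternating-pair : ∀ {k r} q → k ≤ r →
  -1ℤ ℤ.^ suc r ℤ.* (-1ℤ ℤ.^ k ℤ.* (ℤ.- q) ℤ.^ (suc r ∸ k) ℤ.+ -1ℤ ℤ.^ suc k ℤ.* (ℤ.- q) ℤ.^ (r ∸ k))
    ≡ (1ℤ ℤ.+ q) ℤ.* q ℤ.^ (r ∸ k)
alternating-pair {r = r} q z≤n = leading r
  where
  leading : ∀ r → -1ℤ ℤ.^ suc r ℤ.* (1ℤ ℤ.* (ℤ.- q) ℤ.^ suc r ℤ.+ -1ℤ ℤ.* 1ℤ ℤ.* (ℤ.- q) ℤ.^ r)
                    ≡ (1ℤ ℤ.+ q) ℤ.* q ℤ.^ r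
  leading zero    = base q
    where
    base : ∀ q → -1ℤ ℤ.* 1ℤ ℤ.* (1ℤ ℤ.* (ℤ.- q ℤ.* 1ℤ) ℤ.+ -1ℤ ℤ.* 1ℤ ℤ.* 1ℤ) ≡ (1ℤ ℤ.+ q) ℤ.* 1ℤ
    base = solve-∀
  leading (suc r) =
    trans (shift (-1ℤ ℤ.^ suc r) ((ℤ.- q) ℤ.^ r) q)
          (trans (cong (q ℤ.*_) (leading r)) (swap q (q ℤ.^ r)))
    where
    shift : ∀ S P q → -1ℤ ℤ.* S ℤ.* (1ℤ ℤ.* (ℤ.- q ℤ.* (ℤ.- q ℤ.* P)) ℤ.+ -1ℤ ℤ.* 1ℤ ℤ.* (ℤ.- q ℤ.* P))
                        ≡ q ℤ.* (S ℤ.* (1ℤ ℤ.* (ℤ.- q ℤ.* P) ℤ.+ -1ℤ ℤ.* 1ℤ ℤ.* P))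
    shift = solve-∀
    swap : ∀ q Q → q ℤ.* ((1ℤ ℤ.+ q) ℤ.* Q) ≡ (1ℤ ℤ.+ q) ℤ.* (q ℤ.* Q)
    swap = solve-∀
alternating-pair {suc k} {suc r} q (s≤s k≤r) =
  trans (flip-signs (-1ℤ ℤ.^ suc r) (-1ℤ ℤ.^ k) ((ℤ.- q) ℤ.^ (suc r ∸ k)) ((ℤ.- q) ℤ.^ (r ∸ k)))
        (alternating-pair q k≤r)
  where
  flip-signs : ∀ S u X Y → -1ℤ ℤ.* S ℤ.* (-1ℤ ℤ.* u ℤ.* X ℤ.+ -1ℤ ℤ.* (-1ℤ ℤ.* u) ℤ.* Y)
                             ≡ S ℤ.* (u ℤ.* X ℤ.+ -1ℤ ℤ.* u ℤ.* Y)
  flip-signs = solve-∀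

alternating-cancel : ∀ k x → -1ℤ ℤ.^ k ℤ.* x ℤ.+ -1ℤ ℤ.^ suc k ℤ.* x ≡ 0ℤ
alternating-cancel k x = cancel (-1ℤ ℤ.^ k) x
  where
  cancel : ∀ u x → u ℤ.* x ℤ.+ -1ℤ ℤ.* u ℤ.* x ≡ 0ℤ
  cancel = solve-∀

-- χ N q and fpoly N q unfold to the sums of these terms over allSubsets n.
χ-term : ∀ {n} → IndepPred n → ℤ → Subset n → ℤ
χ-term N q A = -1ℤ ℤ.^ ∣ A ∣ ℤ.* q ℤ.^ (rank N ∸ rk N A)

f-term : ∀ {n} → IndepPred n → ℤ → Subset n → ℤ
f-term N q A = if N A then q ℤ.^ (rank N ∸ ∣ A ∣) else 0ℤ

module _ {n} {I : IndepPred n} (M : IsMatroid I) (q : ℤ) where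
  open MatroidProperties M
  open FreeCoextensionProperties M

  -- A χ-term pair as a function of the three ranks in it, so that these can be replaced by
  -- congruence; rewriting the goal instead would normalise rank (freeCoext I).
  private
    signed-pair : ℕ → ℕ → ℕ → ℕ → ℤ
    signed-pair k R a b = -1ℤ ℤ.^ k ℤ.* (ℤ.- q) ℤ.^ (R ∸ a) ℤ.+ -1ℤ ℤ.^ suc k ℤ.* (ℤ.- q) ℤ.^ (R ∸ b)

    signed-pair-cong : ∀ {k R R′ a a′ b b′} → R ≡ R′ → a ≡ a′ → b ≡ b′ →
                       signed-pair k R a b ≡ signed-pair k R′ a′ b′
    signed-pair-cong refl refl refl = refl

  χ-term-freeCoext-pair : ∀ A →
    -1ℤ ℤ.^ suc (rank I) ℤ.* (χ-term (freeCoext I) (ℤ.- q) (false ∷ A) ℤ.+ χ-term (freeCoext I) (ℤ.- q) (true ∷ A))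
      ≡ (1ℤ ℤ.+ q) ℤ.* f-term I q A
  χ-term-freeCoext-pair A = by-independence (I A) refl
    where
    c : ℤ
    c = -1ℤ ℤ.^ suc (rank I)
    by-independence : ∀ b → I A ≡ b →
      c ℤ.* signed-pair ∣ A ∣ (rank (freeCoext I)) (rk (freeCoext I) (false ∷ A)) (rk (freeCoext I) (true ∷ A))
        ≡ (1ℤ ℤ.+ q) ℤ.* (if b then q ℤ.^ (rank I ∸ ∣ A ∣) else 0ℤ)
    by-independence true IA = trans
      (cong (ℤ._*_ c) (signed-pair-cong {∣ A ∣} rank-freeCoext (rk-freeCoext-outside-indep IA)
                                         (trans (rk-freeCoext-inside A) (cong suc (indep⇒rk≡∣∣ IA)))))
      (alternating-pair q (subst (_≤ rank I) (indep⇒rk≡∣∣ IA) (rk≤rank I A)))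
    by-independence false IA = trans
      (cong (ℤ._*_ c) (trans (signed-pair-cong {∣ A ∣} rank-freeCoext
                                                 (rk-freeCoext-outside-dependent IA) (rk-freeCoext-inside A))
                             (alternating-cancel ∣ A ∣ _)))
      (trans (ℤ.*-zeroʳ c) (sym (ℤ.*-zeroʳ (1ℤ ℤ.+ q))))

proposition3p3 : (n : ℕ) (I : IndepPred n) → IsMatroid I → (q : ℤ) →
    ((ℤ.- (ℤ.+ 1)) ℤ.^ suc (rank I)) ℤ.* χ (freeCoext I) (ℤ.- q) ≡ (ℤ.+ 1 ℤ.+ q) ℤ.* fpoly I q
proposition3p3 n I M q = begin
  c ℤ.* sumℤ (map t (allSubsets (suc n)))                  ≡⟨ cong (ℤ._*_ c) (sumℤ-allSubsets-suc t) ⟩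
  c ℤ.* sumℤ (map (λ A → t (false ∷ A) ℤ.+ t (true ∷ A)) L)  ≡⟨ sumℤ-map-*ˡ c _ L ⟩
  sumℤ (map (λ A → c ℤ.* (t (false ∷ A) ℤ.+ t (true ∷ A))) L) ≡⟨ cong sumℤ (map-cong (χ-term-freeCoext-pair M q) L) ⟩
  sumℤ (map (λ A → (1ℤ ℤ.+ q) ℤ.* f-term I q A) L)         ≡⟨ sumℤ-map-*ˡ (1ℤ ℤ.+ q) (f-term I q) L ⟨
  (1ℤ ℤ.+ q) ℤ.* fpoly I q                                ∎
  where
  open ≡-Reasoning
  c : ℤ
  c = -1ℤ ℤ.^ suc (rank I)
  t : Subset (suc n) → ℤ
  t = χ-term (freeCoext I) (ℤ.- q)
  L : List (Subset n)
  L = allSubsets n
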